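{- Let $N$ be a $k$-commodity network and let $\mathcal{C}$ be the set of all $s$--$t$ cuts of $N$. Then the set of feasible flows through $N$ is precisely the mutual capacity of $\mathcal{C}$: a map is a flow on $N$ if and only if it is a local flow over $\mathcal{C}$, i.e., the gluing of a compatible family of local flows, one over each cut of $\mathcal{C}$.
   Context: A $k$-commodity network $N$ is a directed graph with node set $V$, arc set $E$, source $s$, sink $t$, each arc $a$ having a capacity $C_a\subseteq\mathbb{R}^k$ (an arbitrary region), enhanced by an arc $e$ from $t$ to $s$ with capacity the nonnegative orthant. A flow is a map $\phi:E\cup\{e\}\to\mathbb{R}^k$ such that at every node the sum of $\phi$ over outgoing arcs equals the sum over incoming arcs (counting $e$), and $\phi(a)\in C_a$ for every arc $a$; its flow value is $\phi(e)$. An $s$--$t$ cut is a partition $V=S\sqcup T$ with $s\in S$, $t\in T$; its forward arcs are the arcs from $S$ to $T$, its backward arcs those from $T$ to $S$, and $e$ belongs to every cut. For a set of cuts $\mathcal{C}$, $E(\mathcal{C})$ is the union of their arc sets. A local flow over $\mathcal{C}$ is a map $\phi_L:E(\mathcal{C})\cup\{e\}\to\mathbb{R}^k$ with $\phi_L(a)\in C_a$ for every arc in its domain and $\phi_L(e)=\sum_{a\in F_c}\phi_L(a)-\sum_{a\in B_c}\phi_L(a)$ for each $c\in\mathcal{C}$ ($F_c$, $B_c$ the forward and backward arcs of $c$ in $E$). Local flows are compatible if they agree on every common arc; the gluing of a compatible family is the map on the union of their domains agreeing with each member. The mutual capacity of $\mathcal{C}$ is the set of local flows over $\mathcal{C}$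 (equivalently, indexed by their flow values, the set of flow values $f$ admitting an assignment to the arcs of $E(\mathcal{C})$ respecting capacities with total value $f$ over every cut in $\mathcal{C}$). -}

module Defs where

open import Level using (Level; _⊔_) renaming (suc to lsuc)
open import Algebra.Bundles using (AbelianGroup)
open import Data.Nat using (ℕ)
open import Data.Fin using (Fin; zero; suc; _≟_)
open import Data.Bool using (Bool; true; false; if_then_else_; _∧_; not)
open import Data.Product using (Σ; _×_; _,_)
open import Relation.Nullary using (does; ¬_)
open import Relation.Binary using (Rel)
open import Relation.Binary.PropositionalEquality using (_≡_; _≢_)
open import Relation.Unary using (Pred; _∈_)

-- Commodity space: k-vectors (Fin k → A) over an abelian group A
-- (standing for ℝ, with ℝ^k = Fin k → ℝ), with an order relation _≤_ on A
-- used only to define the nonnegative orthant (capacity of the arc e).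
module Commodities {c ℓ ℓ≤ : Level} (A : AbelianGroup c ℓ)
                   (_≤_ : Rel (AbelianGroup.Carrier A) ℓ≤) (k : ℕ) where
  open AbelianGroup A renaming (Carrier to R)

  Vecᵏ : Set c
  Vecᵏ = Fin k → R

  _⊕_ : Vecᵏ → Vecᵏ → Vecᵏ
  (x ⊕ y) i = x i ∙ y i

  _⊖_ : Vecᵏ → Vecᵏ → Vecᵏ
  (x ⊖ y) i = x i ∙ (y i ⁻¹)

  𝟎 : Vecᵏ
  𝟎 i = ε

  _≋_ : Vecᵏ → Vecᵏ → Set ℓ
  x ≋ y = ∀ i → x i ≈ y i

  Orthant : Pred Vecᵏ ℓ≤
  Orthant x = ∀ i → ε ≤ x i

  Σ[_] : ∀ {m} → (Fin m → Vecᵏ) → Vecᵏ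
  Σ[_] {ℕ.zero}  f = 𝟎
  Σ[_] {ℕ.suc m} f = f zero ⊕ Σ[ (λ a → f (suc a)) ]

  Σ-when : ∀ {m} → (Fin m → Bool) → (Fin m → Vecᵏ) → Vecᵏ
  Σ-when P f = Σ[ (λ a → if P a then f a else 𝟎) ]

  -- A k-commodity network: n nodes (Fin n), m arcs (Fin m), each arc a
  -- going from src a to tgt a with arbitrary capacity region cap a ⊆ ℝ^k;
  -- the extra arc e from t to s (capacity: nonnegative orthant) is
  -- represented implicitly by the flow value.
  record Network (ℓc : Level) : Set (c ⊔ lsuc ℓc) where
    field
      n m  : ℕ
      src tgt : Fin m → Fin n
      s t  : Fin n
      cap  : Fin m → Pred Vecᵏ ℓc

  module _ {ℓc : Level} (N : Network ℓc) where
    open Network N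

    -- A map E ∪ {e} → ℝ^k is given as φ : Fin m → ℝ^k together with the
    -- value f = φ(e).
    -- Flow: conservation at every node (counting e : t → s) and capacities.
    IsFlow : (Fin m → Vecᵏ) → Vecᵏ → Set (ℓ ⊔ ℓ≤ ⊔ ℓc)
    IsFlow φ f =
        (∀ v → (Σ-when (λ a → does (src a ≟ v)) φ ⊕ (if does (t ≟ v) then f else 𝟎))
             ≋ (Σ-when (λ a → does (tgt a ≟ v)) φ ⊕ (if does (s ≟ v) then f else 𝟎)))
      × (∀ a → φ a ∈ cap a)
      × f ∈ Orthant

    record Cut : Set where
      field
        S    : Fin n → Bool
        s∈S  : S s ≡ true
        t∉S  : S t ≡ false

    forward : Cut → Fin m → Bool
    forward C a = Cut.S C (src a) ∧ not (Cut.S C (tgt a))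

    backward : Cut → Fin m → Bool
    backward C a = not (Cut.S C (src a)) ∧ Cut.S C (tgt a)

    InCut : Cut → Fin m → Set
    InCut C a = (forward C a ≡ true) Data.Sum.⊎ (backward C a ≡ true)
      where import Data.Sum

    InE : ∀ {ℓ𝒞} → Pred Cut ℓ𝒞 → Pred (Fin m) ℓ𝒞
    InE 𝒞 a = Σ Cut (λ C → 𝒞 C × InCut C a)

    -- Local flow over 𝒞: the map (φ restricted to E(𝒞), together with f = φ(e))
    -- respects capacities on E(𝒞) ∪ {e}, and for every cut in 𝒞 the value f
    -- equals forward minus backward arc flow. (Values of φ outside E(𝒞) are
    -- irrelevant.) The mutual capacity of 𝒞 is the set of such local flows.
    IsLocalFlow : ∀ {ℓ𝒞} → Pred Cut ℓ𝒞 → (Fin m → Vecᵏ) → Vecᵏ → Set (ℓ ⊔ ℓ≤ ⊔ ℓc ⊔ ℓ𝒞)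
    IsLocalFlow 𝒞 φ f =
        (∀ a → InE 𝒞 a → φ a ∈ cap a)
      × f ∈ Orthant
      × (∀ C → 𝒞 C → f ≋ (Σ-when (forward C) φ ⊖ Σ-when (backward C) φ))

    AllCuts : Pred Cut Level.zero
    AllCuts _ = Data.Unit.⊤
      where import Data.Unit

-- Summing the conservation law over the source side S of a cut, every arc with both ends
-- in S cancels, and what remains is (flow leaving S) − (flow entering S) = f; so a flow is
-- a local flow over all cuts. Conversely, the cut sums determine the conservation law at
-- each node: the cut {s} gives it at s, the cuts {s} and {s, v} together give it at any
-- other v ≠ t, and the cut V ∖ {t} together with the trivial balance over all of V gives it
-- at t. Capacities transfer because, in a loop-free network with s ≠ t, every arc lies in
-- some cut. All of this happens in an arbitrary abelian group, here the pointwise group Aᵏ.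
module Submission where

open import Defs
open import Level using (Level)
open import Algebra.Bundles using (CommutativeMonoid; AbelianGroup)
open import Algebra.Construct.Pointwise using (abelianGroup)
open import Data.Nat using (ℕ)
open import Data.Fin using (Fin; zero; suc; _≟_)
open import Data.Bool using (Bool; true; false; if_then_else_; _∧_; _∨_; not)
open import Data.Bool.Properties using (∨-zeroʳ)
open import Data.Product using (_,_)
open import Data.Sum using (inj₁; inj₂)
open import Data.Unit using (tt)
open import Function.Base using (_∘_)
open import Function.Bundles using (_⇔_; mk⇔; Equivalence)
open import Relation.Nullary using (does; yes; no)
open import Relation.Nullary.Decidable using (dec-true; dec-false)
open import Relation.Binary using (Rel)
open import Relation.Binary.PropositionalEquality as ≡ using (_≡_; _≢_)

singleton : ∀ {n} → Fin n → Fin n → Bool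
singleton u v = does (u ≟ v)

pair : ∀ {n} → Fin n → Fin n → Fin n → Bool
pair u w v = singleton u v ∨ singleton w v

allBut : ∀ {n} → Fin n → Fin n → Bool
allBut u v = not (singleton u v)

singleton-∋ : ∀ {n} (u : Fin n) → singleton u u ≡ true
singleton-∋ u = dec-true (u ≟ u) ≡.refl

singleton-∌ : ∀ {n} {u v : Fin n} → u ≢ v → singleton u v ≡ false
singleton-∌ {u = u} {v} = dec-false (u ≟ v)

pair-∋ˡ : ∀ {n} (u w : Fin n) → pair u w u ≡ true
pair-∋ˡ u w = ≡.cong (_∨ singleton w u) (singleton-∋ u)

pair-∋ʳ : ∀ {n} (u w : Fin n) → pair u w w ≡ true
pair-∋ʳ u w = ≡.trans (≡.cong (singleton u w ∨_) (singleton-∋ w)) (∨-zeroʳ (singleton u w))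

pair-∌ : ∀ {n} {u w v : Fin n} → u ≢ v → w ≢ v → pair u w v ≡ false
pair-∌ u≢v w≢v = ≡.cong₂ _∨_ (singleton-∌ u≢v) (singleton-∌ w≢v)

allBut-∋ : ∀ {n} {u v : Fin n} → u ≢ v → allBut u v ≡ true
allBut-∋ u≢v = ≡.cong not (singleton-∌ u≢v)

allBut-∌ : ∀ {n} (u : Fin n) → allBut u u ≡ false
allBut-∌ u = ≡.cong not (singleton-∋ u)

singleton-∧-singleton : ∀ {n} {u w : Fin n} → u ≢ w → ∀ v → singleton u v ∧ singleton w v ≡ false
singleton-∧-singleton {u = u} {w} u≢w v with u ≟ v
... | yes ≡.refl = singleton-∌ (u≢w ∘ ≡.sym)
... | no _ = ≡.refl

module SelectiveSums {c ℓ} (M : CommutativeMonoid c ℓ) where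
  open CommutativeMonoid M
  open import Algebra.Properties.CommutativeMonoid.Sum M
    using (sum; sum-cong-≋; ∑-distrib-+; ∑-comm; sum-replicate-zero) public
  open import Relation.Binary.Reasoning.Setoid setoid

  when : Bool → Carrier → Carrier
  when b x = if b then x else ε

  ∑-when : ∀ {m} → (Fin m → Bool) → (Fin m → Carrier) → Carrier
  ∑-when P g = sum (λ a → when (P a) (g a))

  when-cong : ∀ b {x y} → x ≈ y → when b x ≈ when b y
  when-cong true  x≈y = x≈y
  when-cong false _   = refl

  when-∙ : ∀ b x y → when b (x ∙ y) ≈ when b x ∙ when b y
  when-∙ true  x y = refl
  when-∙ false x y = sym (identityˡ ε)

  when-when : ∀ b d x → when b (when d x) ≡ when d (when b x)
  when-when true  d     x = ≡.refl
  when-when false true  x = ≡.refl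
  when-when false false x = ≡.refl

  when-∨ : ∀ p q x → p ∧ q ≡ false → when (p ∨ q) x ≈ when p x ∙ when q x
  when-∨ true  false x _ = sym (identityʳ x)
  when-∨ false true  x _ = sym (identityˡ x)
  when-∨ false false x _ = sym (identityˡ ε)

  when-not-∙-when : ∀ b x → when (not b) x ∙ when b x ≈ x
  when-not-∙-when true  x = identityˡ x
  when-not-∙-when false x = identityʳ x

  when-crossing : ∀ p q x → when p x ∙ when (not p ∧ q) x ≈ when q x ∙ when (p ∧ not q) x
  when-crossing true  true  x = refl
  when-crossing true  false x = comm x ε
  when-crossing false true  x = comm ε x
  when-crossing false false x = refl

  when-sum : ∀ {m} b (g : Fin m → Carrier) → when b (sum g) ≈ ∑-when (λ _ → b) g
  when-sum true  g = refl
  when-sum {m} false g = sym (sum-replicate-zero m)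

  ∑-when-∙ : ∀ {m} P (g h : Fin m → Carrier) → ∑-when P (λ a → g a ∙ h a) ≈ ∑-when P g ∙ ∑-when P h
  ∑-when-∙ P g h = trans (sum-cong-≋ (λ a → when-∙ (P a) (g a) (h a)))
                         (∑-distrib-+ (λ a → when (P a) (g a)) (λ a → when (P a) (h a)))

  ∑-when-singleton : ∀ {n} (u : Fin n) (g : Fin n → Carrier) → ∑-when (singleton u) g ≈ g u
  ∑-when-singleton {ℕ.suc n} zero    g = trans (∙-congˡ (sum-replicate-zero n)) (identityʳ (g zero))
  ∑-when-singleton         (suc u) g = trans (identityˡ _) (∑-when-singleton u (g ∘ suc))

  ∑-when-pair : ∀ {n} {u w : Fin n} → u ≢ w → (g : Fin n → Carrier) → ∑-when (pair u w) g ≈ g u ∙ g w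
  ∑-when-pair {u = u} {w} u≢w g = begin
    ∑-when (pair u w) g
      ≈⟨ sum-cong-≋ (λ v → when-∨ (singleton u v) (singleton w v) (g v) (singleton-∧-singleton u≢w v)) ⟩
    sum (λ v → when (singleton u v) (g v) ∙ when (singleton w v) (g v))
      ≈⟨ ∑-distrib-+ (λ v → when (singleton u v) (g v)) (λ v → when (singleton w v) (g v)) ⟩
    ∑-when (singleton u) g ∙ ∑-when (singleton w) g
      ≈⟨ ∙-cong (∑-when-singleton u g) (∑-when-singleton w g) ⟩
    g u ∙ g w ∎

  sum≈∑-when-allBut : ∀ {n} (u : Fin n) (g : Fin n → Carrier) → sum g ≈ ∑-when (allBut u) g ∙ g u
  sum≈∑-when-allBut u g = begin
    sum g
      ≈⟨ sum-cong-≋ (λ v → when-not-∙-when (singleton u v) (g v)) ⟨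
    sum (λ v → when (allBut u v) (g v) ∙ when (singleton u v) (g v))
      ≈⟨ ∑-distrib-+ (λ v → when (allBut u v) (g v)) (λ v → when (singleton u v) (g v)) ⟩
    ∑-when (allBut u) g ∙ ∑-when (singleton u) g
      ≈⟨ ∙-congˡ (∑-when-singleton u g) ⟩
    ∑-when (allBut u) g ∙ g u ∎

  ∑-when-fibres : ∀ {n m} (S : Fin n → Bool) (h : Fin m → Fin n) (ψ : Fin m → Carrier) →
                  ∑-when S (λ v → ∑-when (λ a → singleton (h a) v) ψ) ≈ ∑-when (S ∘ h) ψ
  ∑-when-fibres S h ψ = begin
    ∑-when S (λ v → ∑-when (λ a → singleton (h a) v) ψ)
      ≈⟨ sum-cong-≋ (λ v → when-sum (S v) (λ a → when (singleton (h a) v) (ψ a))) ⟩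
    sum (λ v → sum (λ a → when (S v) (when (singleton (h a) v) (ψ a))))
      ≈⟨ ∑-comm (λ v a → when (S v) (when (singleton (h a) v) (ψ a))) ⟩
    sum (λ a → sum (λ v → when (S v) (when (singleton (h a) v) (ψ a))))
      ≈⟨ sum-cong-≋ (λ a → sum-cong-≋ (λ v → reflexive (when-when (S v) (singleton (h a) v) (ψ a)))) ⟩
    sum (λ a → ∑-when (singleton (h a)) (λ v → when (S v) (ψ a)))
      ≈⟨ sum-cong-≋ (λ a → ∑-when-singleton (h a) (λ v → when (S v) (ψ a))) ⟩
    ∑-when (S ∘ h) ψ ∎

module GroupValuedFlows {c ℓ} (G : AbelianGroup c ℓ) where
  open AbelianGroup G
  open SelectiveSums commutativeMonoid
  open import Algebra.Properties.Group group using (∙-cancelˡ; ∙-cancelʳ; x≈z//y; //-rightDividesˡ)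
  open import Relation.Binary.Reasoning.Setoid setoid

  x≈z-y⇔u≈w∙x : ∀ {u w x y z} → u ∙ y ≈ w ∙ z → x ≈ z - y ⇔ u ≈ w ∙ x
  x≈z-y⇔u≈w∙x {u} {w} {x} {y} {z} uy≈wz = mk⇔
    (λ x≈z-y → ∙-cancelʳ y u (w ∙ x) (begin
      u ∙ y            ≈⟨ uy≈wz ⟩
      w ∙ z            ≈⟨ ∙-congˡ (//-rightDividesˡ y z) ⟨
      w ∙ ((z - y) ∙ y) ≈⟨ ∙-congˡ (∙-congʳ x≈z-y) ⟨
      w ∙ (x ∙ y)      ≈⟨ assoc w x y ⟨
      w ∙ x ∙ y        ∎))
    (λ u≈wx → x≈z//y x y z (∙-cancelˡ w (x ∙ y) z (begin
      w ∙ (x ∙ y)      ≈⟨ assoc w x y ⟨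
      w ∙ x ∙ y        ≈⟨ ∙-congʳ u≈wx ⟨
      u ∙ y            ≈⟨ uy≈wz ⟩
      w ∙ z            ∎)))

  module _ {n} {s t : Fin n} (s≢t : s ≢ t) (x y : Fin n → Carrier)
           (cut : ∀ S → S s ≡ true → S t ≡ false → ∑-when S x ≈ ∑-when S y)
           (total : sum x ≈ sum y) where

    private
      at-source : x s ≈ y s
      at-source = begin
        x s                      ≈⟨ ∑-when-singleton s x ⟨
        ∑-when (singleton s) x   ≈⟨ cut (singleton s) (singleton-∋ s) (singleton-∌ s≢t) ⟩
        ∑-when (singleton s) y   ≈⟨ ∑-when-singleton s y ⟩
        y s                      ∎

      at-sink : x t ≈ y t
      at-sink = ∙-cancelˡ (∑-when (allBut t) x) (x t) (y t) (begin
        ∑-when (allBut t) x ∙ x t   ≈⟨ sum≈∑-when-allBut t x ⟨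
        sum x                       ≈⟨ total ⟩
        sum y                       ≈⟨ sum≈∑-when-allBut t y ⟩
        ∑-when (allBut t) y ∙ y t   ≈⟨ ∙-congʳ cut-allBut ⟨
        ∑-when (allBut t) x ∙ y t   ∎)
        where
        cut-allBut : ∑-when (allBut t) x ≈ ∑-when (allBut t) y
        cut-allBut = cut (allBut t) (allBut-∋ (s≢t ∘ ≡.sym)) (allBut-∌ t)

      elsewhere : ∀ {w} → w ≢ s → w ≢ t → x w ≈ y w
      elsewhere {w} w≢s w≢t = ∙-cancelˡ (x s) (x w) (y w) (begin
        x s ∙ x w             ≈⟨ ∑-when-pair s≢w x ⟨
        ∑-when (pair s w) x   ≈⟨ cut (pair s w) (pair-∋ˡ s w) (pair-∌ s≢t w≢t) ⟩
        ∑-when (pair s w) y   ≈⟨ ∑-when-pair s≢w y ⟩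
        y s ∙ y w             ≈⟨ ∙-congʳ at-source ⟨
        x s ∙ y w             ∎)
        where
        s≢w : s ≢ w
        s≢w = w≢s ∘ ≡.sym

    ≈-from-cut-sums : ∀ v → x v ≈ y v
    ≈-from-cut-sums v with v ≟ s | v ≟ t
    ... | yes ≡.refl | _          = at-source
    ... | no _       | yes ≡.refl = at-sink
    ... | no v≢s     | no v≢t     = elsewhere v≢s v≢t

  module Flow {n m} (src tgt : Fin m → Fin n) (s t : Fin n) (φ : Fin m → Carrier) (f : Carrier) where

    arcsAt : (Fin m → Fin n) → Fin n → Carrier
    arcsAt end v = ∑-when (λ a → singleton (end a) v) φ

    -- including the return arc e : t → s, which carries f
    outflow inflow : Fin n → Carrier
    outflow v = arcsAt src v ∙ when (singleton t v) f
    inflow  v = arcsAt tgt v ∙ when (singleton s v) f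

    leaving entering : (Fin n → Bool) → Fin m → Bool
    leaving  S a = S (src a) ∧ not (S (tgt a))
    entering S a = not (S (src a)) ∧ S (tgt a)

    ∑-when-arcsAt-∙-when : ∀ S end u →
      ∑-when S (λ v → arcsAt end v ∙ when (singleton u v) f) ≈ ∑-when (S ∘ end) φ ∙ when (S u) f
    ∑-when-arcsAt-∙-when S end u = begin
      ∑-when S (λ v → arcsAt end v ∙ when (singleton u v) f)
        ≈⟨ ∑-when-∙ S (arcsAt end) (λ v → when (singleton u v) f) ⟩
      ∑-when S (arcsAt end) ∙ ∑-when S (λ v → when (singleton u v) f)
        ≈⟨ ∙-cong (∑-when-fibres S end φ) (sum-cong-≋ (λ v → reflexive (when-when (S v) (singleton u v) f))) ⟩
      ∑-when (S ∘ end) φ ∙ ∑-when (singleton u) (λ v → when (S v) f)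
        ≈⟨ ∙-congˡ (∑-when-singleton u (λ v → when (S v) f)) ⟩
      ∑-when (S ∘ end) φ ∙ when (S u) f ∎

    ∑-when-crossing : ∀ S → ∑-when (S ∘ src) φ ∙ ∑-when (entering S) φ
                          ≈ ∑-when (S ∘ tgt) φ ∙ ∑-when (leaving S) φ
    ∑-when-crossing S = begin
      ∑-when (S ∘ src) φ ∙ ∑-when (entering S) φ
        ≈⟨ ∑-distrib-+ (λ a → when (S (src a)) (φ a)) (λ a → when (entering S a) (φ a)) ⟨
      sum (λ a → when (S (src a)) (φ a) ∙ when (entering S a) (φ a))
        ≈⟨ sum-cong-≋ (λ a → when-crossing (S (src a)) (S (tgt a)) (φ a)) ⟩
      sum (λ a → when (S (tgt a)) (φ a) ∙ when (leaving S a) (φ a))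
        ≈⟨ ∑-distrib-+ (λ a → when (S (tgt a)) (φ a)) (λ a → when (leaving S a) (φ a)) ⟩
      ∑-when (S ∘ tgt) φ ∙ ∑-when (leaving S) φ ∎

    cut-value⇔cut-balance : ∀ {S} → S s ≡ true → S t ≡ false →
      f ≈ ∑-when (leaving S) φ - ∑-when (entering S) φ ⇔ ∑-when S outflow ≈ ∑-when S inflow
    cut-value⇔cut-balance {S} s∈S t∉S = mk⇔
      (λ value → trans source-side (trans (Equivalence.to exchange value) (sym sink-side)))
      (λ balance → Equivalence.from exchange (trans (sym source-side) (trans balance sink-side)))
      where
      exchange : f ≈ ∑-when (leaving S) φ - ∑-when (entering S) φ
               ⇔ ∑-when (S ∘ src) φ ≈ ∑-when (S ∘ tgt) φ ∙ f
      exchange = x≈z-y⇔u≈w∙x (∑-when-crossing S)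

      source-side : ∑-when S outflow ≈ ∑-when (S ∘ src) φ
      source-side = begin
        ∑-when S outflow                  ≈⟨ ∑-when-arcsAt-∙-when S src t ⟩
        ∑-when (S ∘ src) φ ∙ when (S t) f ≡⟨ ≡.cong (λ b → ∑-when (S ∘ src) φ ∙ when b f) t∉S ⟩
        ∑-when (S ∘ src) φ ∙ ε            ≈⟨ identityʳ _ ⟩
        ∑-when (S ∘ src) φ                ∎

      sink-side : ∑-when S inflow ≈ ∑-when (S ∘ tgt) φ ∙ f
      sink-side = begin
        ∑-when S inflow                   ≈⟨ ∑-when-arcsAt-∙-when S tgt s ⟩
        ∑-when (S ∘ tgt) φ ∙ when (S s) f ≡⟨ ≡.cong (λ b → ∑-when (S ∘ tgt) φ ∙ when b f) s∈S ⟩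
        ∑-when (S ∘ tgt) φ ∙ f            ∎

    total-balance : sum outflow ≈ sum inflow
    total-balance = trans (∑-when-arcsAt-∙-when (λ _ → true) src t)
                          (sym (∑-when-arcsAt-∙-when (λ _ → true) tgt s))

    conservation⇔cut-values : s ≢ t →
      (∀ v → outflow v ≈ inflow v) ⇔
      (∀ S → S s ≡ true → S t ≡ false → f ≈ ∑-when (leaving S) φ - ∑-when (entering S) φ)
    conservation⇔cut-values s≢t = mk⇔
      (λ conserved S s∈S t∉S → Equivalence.from (cut-value⇔cut-balance s∈S t∉S)
                                  (sum-cong-≋ (λ v → when-cong (S v) (conserved v))))
      (λ values → ≈-from-cut-sums s≢t outflow inflow
                    (λ S s∈S t∉S → Equivalence.to (cut-value⇔cut-balance s∈S t∉S) (values S s∈S t∉S))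
                    total-balance)

module CommodityFlows {c ℓ ℓ≤ ℓc} {A : AbelianGroup c ℓ} {_≤_ : Rel (AbelianGroup.Carrier A) ℓ≤} {k : ℕ}
                      (N : Commodities.Network A _≤_ k ℓc) where
  open Commodities A _≤_ k
  open Network N

  -- Σ[_], _⊕_, _⊖_, 𝟎 and _≋_ are (up to Σ≡sum) the sum, operations and equality of Aᵏ.
  Aᵏ : AbelianGroup c ℓ
  Aᵏ = abelianGroup (Fin k) A

  open AbelianGroup Aᵏ using (_≈_; _-_)
  open SelectiveSums (AbelianGroup.commutativeMonoid Aᵏ) using (sum; ∑-when)
  open GroupValuedFlows Aᵏ using (module Flow)

  Σ≡sum : ∀ {m} (F : Fin m → Vecᵏ) → Σ[ F ] ≡ sum F
  Σ≡sum {ℕ.zero}  F = ≡.refl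
  Σ≡sum {ℕ.suc m} F = ≡.cong (F zero ⊕_) (Σ≡sum (F ∘ suc))

  mkCut : (S : Fin n → Bool) → S s ≡ true → S t ≡ false → Cut N
  mkCut S s∈S t∉S = record { S = S ; s∈S = s∈S ; t∉S = t∉S }

  arc-in-some-cut : s ≢ t → (∀ a → src a ≢ tgt a) → ∀ a → InE N (AllCuts N) a
  arc-in-some-cut s≢t src≢tgt a with tgt a ≟ s | src a ≟ t
  ... | yes tgt≡s | _ = mkCut (singleton s) (singleton-∋ s) (singleton-∌ s≢t) , tt ,
    inj₂ (≡.cong₂ _∧_ (≡.cong not (singleton-∌ λ s≡src → src≢tgt a (≡.sym (≡.trans tgt≡s s≡src))))
                      (≡.trans (≡.cong (singleton s) tgt≡s) (singleton-∋ s)))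
  ... | no tgt≢s | yes src≡t = mkCut (allBut t) (allBut-∋ (s≢t ∘ ≡.sym)) (allBut-∌ t) , tt ,
    inj₂ (≡.cong₂ _∧_ (≡.trans (≡.cong (not ∘ allBut t) src≡t) (≡.cong not (allBut-∌ t)))
                      (allBut-∋ λ t≡tgt → src≢tgt a (≡.trans src≡t t≡tgt)))
  ... | no tgt≢s | no src≢t = mkCut (pair s (src a)) (pair-∋ˡ s (src a)) (pair-∌ s≢t src≢t) , tt ,
    inj₁ (≡.cong₂ _∧_ (pair-∋ʳ s (src a)) (≡.cong not (pair-∌ (tgt≢s ∘ ≡.sym) (src≢tgt a))))

  module _ (φ : Fin m → Vecᵏ) (f : Vecᵏ) where
    open Flow src tgt s t φ f

    Σ-when≡∑-when : ∀ P → Σ-when P φ ≡ ∑-when P φ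
    Σ-when≡∑-when P = Σ≡sum (λ a → if P a then φ a else 𝟎)

    outflow≡ : ∀ v → Σ-when (λ a → does (src a ≟ v)) φ ⊕ (if does (t ≟ v) then f else 𝟎) ≡ outflow v
    outflow≡ v = ≡.cong (_⊕ (if does (t ≟ v) then f else 𝟎)) (Σ-when≡∑-when (λ a → does (src a ≟ v)))

    inflow≡ : ∀ v → Σ-when (λ a → does (tgt a ≟ v)) φ ⊕ (if does (s ≟ v) then f else 𝟎) ≡ inflow v
    inflow≡ v = ≡.cong (_⊕ (if does (s ≟ v) then f else 𝟎)) (Σ-when≡∑-when (λ a → does (tgt a ≟ v)))

    cut-value≡ : ∀ C → Σ-when (forward N C) φ ⊖ Σ-when (backward N C) φ
                     ≡ ∑-when (leaving (Cut.S C)) φ - ∑-when (entering (Cut.S C)) φ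
    cut-value≡ C = ≡.cong₂ _⊖_ (Σ-when≡∑-when (forward N C)) (Σ-when≡∑-when (backward N C))

    flow⇒local-flow : s ≢ t → IsFlow N φ f → IsLocalFlow N (AllCuts N) φ f
    flow⇒local-flow s≢t (conserved , within , f≥0) = (λ a _ → within a) , f≥0 , value-across
      where
      values : ∀ S → S s ≡ true → S t ≡ false → f ≈ ∑-when (leaving S) φ - ∑-when (entering S) φ
      values = Equivalence.to (conservation⇔cut-values s≢t)
                 (λ v → ≡.subst₂ _≋_ (outflow≡ v) (inflow≡ v) (conserved v))

      value-across : ∀ C → AllCuts N C → f ≋ (Σ-when (forward N C) φ ⊖ Σ-when (backward N C) φ)
      value-across C _ = ≡.subst (f ≋_) (≡.sym (cut-value≡ C)) (values (Cut.S C) (Cut.s∈S C) (Cut.t∉S C))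

    local-flow⇒flow : s ≢ t → (∀ a → src a ≢ tgt a) → IsLocalFlow N (AllCuts N) φ f → IsFlow N φ f
    local-flow⇒flow s≢t src≢tgt (within , f≥0 , value-across) =
      conserved , (λ a → within a (arc-in-some-cut s≢t src≢tgt a)) , f≥0
      where
      conserved : ∀ v → (Σ-when (λ a → does (src a ≟ v)) φ ⊕ (if does (t ≟ v) then f else 𝟎))
                      ≋ (Σ-when (λ a → does (tgt a ≟ v)) φ ⊕ (if does (s ≟ v) then f else 𝟎))
      conserved v = ≡.subst₂ _≋_ (≡.sym (outflow≡ v)) (≡.sym (inflow≡ v))
        (Equivalence.from (conservation⇔cut-values s≢t)
          (λ S s∈S t∉S → let C = mkCut S s∈S t∉S in ≡.subst (f ≋_) (cut-value≡ C) (value-across C tt)) v)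

theorem8 : ∀ {c ℓ ℓ≤ ℓc : Level} (A : AbelianGroup c ℓ) (_≤_ : Rel (AbelianGroup.Carrier A) ℓ≤) (k : ℕ)
           (N : Commodities.Network A _≤_ k ℓc) →
           Commodities.Network.s N ≢ Commodities.Network.t N →
           (∀ a → Commodities.Network.src N a ≢ Commodities.Network.tgt N a) →
           ∀ φ f →
           Commodities.IsFlow A _≤_ k N φ f ⇔ Commodities.IsLocalFlow A _≤_ k N (Commodities.AllCuts A _≤_ k N) φ f
theorem8 A _≤_ k N s≢t src≢tgt φ f = mk⇔ (flow⇒local-flow φ f s≢t) (local-flow⇒flow φ f s≢t src≢tgt)
  where open CommodityFlows N
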